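{- Let $G$ be a connected weighted graph with $e(G)\le v(G)+d$ and no pendant edges, let $V_{\ge 3}$ be its set of vertices of degree at least $3$, and let $P_1,\dots,P_w$ be the connected components of $G\setminus V_{\ge 3}$ (which are paths), each with a fixed orientation. Let $H$ be a subgraph of $G$, let $P_i=(u_1e_1u_2e_2\dots e_qu_{q+1})$, and let $e=e_j\in E(H)\cap E(P_i)$. Suppose there is an optimal strategy for $H$ that queries $e$ first. Then there is an optimal contracted decision tree for $H$ whose root is associated to the strategy $S(H,e)$.
   Context: Query-commit problem: weighted graph $G=(V,E,p)$, $p:E\to(0,1]$, isolated nodes ignored; a realization includes each edge $e$ independently with probability $p_e$. A strategy starts with empty matching and residual graph equal to the input graph; querying edge $e$: if $e$ exists, add it to the matching and delete all edges sharing an endpoint with $e$ from the residual graph, else delete $e$; queries depend only on previous outcomes. A strategy is a binary decision tree with internal nodes labeled by edges; each node $x$ has residual graph $H^x$ (root: input graph; right child after success: $H^x\setminus N(a(x))$; left child after failure: $H^x\setminus a(x)$). Optimal = maximizing expected matching size over all strategies. For a strategy $S$ on $H$, $\mathcal{R}(S,H)$ is the set of residual graphs at the leaves of its decision tree. A contracted decision tree (CDT) for $H$ is a rooted tree where each node $x$ has a graph $G^x$ and each internal node $x$ a strategy $S^x$ for $G^x$, such that $G^{root}=H$, each internal node $x$ has exactly $|\mathcal{R}(S^x,G^x)|$ children whose graphs are exactly the elements of $\mathcal{R}(S^x,G^x)$, and $S^x\neq S^y$ whenever $x$ is an ancestor of $y$. It is executed by running $S^{root}$, and then continuing with the subtree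 of the child whose graph equals the obtained residual graph; it is optimal if the resulting strategy is optimal. For $e=e_j$ on the path $P_i=(u_1e_1\dots e_qu_{q+1})$ (with its fixed orientation), $S(H,e)$ is the strategy querying $e_j,e_{j-1},\dots,e_1$ in this order and then $e_{j+1},\dots,e_q$ in this order, ignoring edges not in $H$. -}

module Defs where

open import Data.Nat as ℕ using (ℕ; zero; suc)
open import Data.Bool using (Bool; true; false; if_then_else_; _∨_; _∧_; not)
open import Data.Fin as Fin using (Fin; toℕ; inject₁)
open import Data.Fin.Subset using (Subset; outside; inside)
open import Data.Vec as Vec using (Vec; lookup; tabulate; _[_]≔_)
open import Data.Vec.Properties using (≡-dec)
open import Data.List as List using (List; []; _∷_; _++_; map; filterᵇ; reverse; allFin; length)
open import Data.List.Membership.Propositional using (_∈_; _∉_)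
open import Data.List.Relation.Unary.All using (All)
open import Data.List.Relation.Unary.Unique.Propositional using (Unique)
open import Data.Product using (Σ; ∃; ∃-syntax; _×_; _,_; proj₁; proj₂)
open import Data.Sum using (_⊎_)
open import Data.Empty using (⊥)
open import Data.Unit using (⊤)
open import Relation.Nullary using (¬_; does; Dec)
open import Relation.Binary.PropositionalEquality using (_≡_; _≢_)
import Data.Bool.Properties as BoolP

-- The real numbers, axiomatised as a Dedekind-complete ordered field
-- (every model is isomorphic to ℝ).

record RealField : Set₁ where
  infixl 6 _+_
  infixl 7 _*_
  infix 4 _≤_
  field
    R : Set
    0r 1r : R
    _+_ _*_ : R → R → R
    -_ : R → R
    _≤_ : R → R → Set
    +-assoc : ∀ x y z → (x + y) + z ≡ x + (y + z)
    +-comm : ∀ x y → x + y ≡ y + x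
    +-identityˡ : ∀ x → 0r + x ≡ x
    +-inverseˡ : ∀ x → (- x) + x ≡ 0r
    *-assoc : ∀ x y z → (x * y) * z ≡ x * (y * z)
    *-comm : ∀ x y → x * y ≡ y * x
    *-identityˡ : ∀ x → 1r * x ≡ x
    distribˡ : ∀ x y z → x * (y + z) ≡ x * y + x * z
    0≢1 : 0r ≢ 1r
    *-inverse : ∀ x → x ≢ 0r → ∃[ y ] (y * x ≡ 1r)
    ≤-refl : ∀ x → x ≤ x
    ≤-trans : ∀ {x y z} → x ≤ y → y ≤ z → x ≤ z
    ≤-antisym : ∀ {x y} → x ≤ y → y ≤ x → x ≡ y
    ≤-total : ∀ x y → x ≤ y ⊎ y ≤ x
    +-monoˡ-≤ : ∀ {x y} z → x ≤ y → x + z ≤ y + z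
    *-nonneg : ∀ {x y} → 0r ≤ x → 0r ≤ y → 0r ≤ x * y
    complete : (P : R → Set) → ∃ P → (∃[ b ] (∀ x → P x → x ≤ b)) →
               ∃[ s ] ((∀ x → P x → x ≤ s) × (∀ b → (∀ x → P x → x ≤ b) → s ≤ b))

  _<_ : R → R → Set
  x < y = (x ≤ y) × (x ≢ y)

  _-_ : R → R → R
  x - y = x + (- y)

-- Weighted (simple) graphs.  Vertices Fin n, edges Fin m, each edge has two
-- distinct endpoints, no parallel edges, probabilities p e ∈ (0,1].

SameEnds : ∀ {n} → Fin n × Fin n → Fin n × Fin n → Set
SameEnds (a , b) (c , d) = ((a ≡ c) × (b ≡ d)) ⊎ ((a ≡ d) × (b ≡ c))

record WGraph (ℝ : RealField) : Set where
  open RealField ℝ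
  field
    n m : ℕ
    ends : Fin m → Fin n × Fin n
    loopless : ∀ i → proj₁ (ends i) ≢ proj₂ (ends i)
    simple : ∀ i j → SameEnds (ends i) (ends j) → i ≡ j
    p : Fin m → R
    p-pos : ∀ i → 0r < p i
    p-≤1 : ∀ i → p i ≤ 1r

module _ {ℝ : RealField} (G : WGraph ℝ) where
  open RealField ℝ
  open WGraph G

  incidentᵇ : Fin n → Fin m → Bool
  incidentᵇ v i = does (proj₁ (ends i) Fin.≟ v) ∨ does (proj₂ (ends i) Fin.≟ v)

  Joins : Fin m → Fin n → Fin n → Set
  Joins i u v = SameEnds (ends i) (u , v)

  deg : Fin n → ℕ
  deg v = length (filterᵇ (incidentᵇ v) (allFin m))

  data Reach : Fin n → Fin n → Set where
    here : ∀ {u} → Reach u u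
    step : ∀ {u v w} (i : Fin m) → Reach u v → Joins i v w → Reach u w

  Connected : Set
  Connected = ∀ u v → Reach u v

  NoPendantEdges : Set
  NoPendantEdges = ∀ i → (deg (proj₁ (ends i)) ≢ 1) × (deg (proj₂ (ends i)) ≢ 1)

  -- (us, es) with us = u_1 … u_{q+1}, es = e_1 … e_q is a connected component
  -- of G ∖ V≥3 (the subgraph induced by the vertices of degree < 3), which is
  -- the path u_1 e_1 u_2 … e_q u_{q+1} with this orientation.
  record IsComponentPath (q : ℕ) (us : Fin (suc q) → Fin n) (es : Fin q → Fin m) : Set where
    field
      us-injective : ∀ k l → us k ≡ us l → k ≡ l
      us-notV≥3 : ∀ k → deg (us k) ℕ.< 3
      es-joins : ∀ k → Joins (es k) (us (inject₁ k)) (us (Fin.suc k))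
      closed : ∀ i k v → Joins i (us k) v → deg v ℕ.< 3 → ∃[ l ] (i ≡ es l)

  -- Residual graphs are edge subsets of G (isolated nodes ignored).

  Graph : Set
  Graph = Subset m

  shareEndᵇ : Fin m → Fin m → Bool
  shareEndᵇ e f = incidentᵇ (proj₁ (ends e)) f ∨ incidentᵇ (proj₂ (ends e)) f

  delEdge : Graph → Fin m → Graph
  delEdge H e = H [ e ]≔ outside

  delNbr : Graph → Fin m → Graph
  delNbr H e = tabulate (λ f → if shareEndᵇ e f then outside else lookup H f)

  -- Strategies: binary decision trees; left = failure, right = success.

  data Strategy : Set where
    leaf : Strategy
    query : Fin m → (onFail onSuccess : Strategy) → Strategy

  Valid : Strategy → Graph → Set
  Valid leaf H = ⊤
  Valid (query e l r) H = (lookup H e ≡ inside) × Valid l (delEdge H e) × Valid r (delNbr H e)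

  -- expected size of the matching produced
  expected : Strategy → R
  expected leaf = 0r
  expected (query e l r) = p e * (1r + expected r) + (1r - p e) * expected l

  Optimal : Strategy → Graph → Set
  Optimal S H = Valid S H × (∀ S′ → Valid S′ H → expected S′ ≤ expected S)

  -- residual graphs at the leaves (as a list; R(S,H) is its set of elements)
  residuals : Strategy → Graph → List Graph
  residuals leaf H = H ∷ []
  residuals (query e l r) H = residuals l (delEdge H e) ++ residuals r (delNbr H e)

  data CDT : Set where
    cleaf : Graph → CDT
    cnode : Graph → Strategy → List CDT → CDT

  graphOf : CDT → Graph
  graphOf (cleaf H) = H
  graphOf (cnode H _ _) = H

  -- well-formedness, given the strategies at the strict ancestors
  data WF (ancestors : List Strategy) : CDT → Set where
    wf-leaf : ∀ H → WF ancestors (cleaf H)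
    wf-node : ∀ {H S cs} →
      Valid S H →
      S ∉ ancestors →
      Unique (map graphOf cs) →
      (∀ H′ → H′ ∈ map graphOf cs → H′ ∈ residuals S H) →
      (∀ H′ → H′ ∈ residuals S H → H′ ∈ map graphOf cs) →
      All (WF (S ∷ ancestors)) cs →
      WF ancestors (cnode H S cs)

  _≟G_ : (H H′ : Graph) → Dec (H ≡ H′)
  _≟G_ = ≡-dec BoolP._≟_

  mutual
    execute : CDT → Strategy
    execute (cleaf _) = leaf
    execute (cnode H S cs) = graft S H cs

    graft : Strategy → Graph → List CDT → Strategy
    graft leaf H cs = continue H cs
    graft (query e l r) H cs = query e (graft l (delEdge H e) cs) (graft r (delNbr H e) cs)

    continue : Graph → List CDT → Strategy
    continue H [] = leaf
    continue H (c ∷ cs) = if does (graphOf c ≟G H) then execute c else continue H cs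

  IsCDT : CDT → Graph → Set
  IsCDT T H = (graphOf T ≡ H) × WF [] T

  OptimalCDT : CDT → Graph → Set
  OptimalCDT T H = IsCDT T H × Optimal (execute T) H

  -- S(H, e_j): query e_j, e_{j-1}, …, e_1, then e_{j+1}, …, e_q, skipping
  -- edges not present in the current residual graph.

  sequential : List (Fin m) → Graph → Strategy
  sequential [] H = leaf
  sequential (f ∷ fs) H with lookup H f
  ... | true = query f (sequential fs (delEdge H f)) (sequential fs (delNbr H f))
  ... | false = sequential fs H

  pathOrder : ∀ {q} → (Fin q → Fin m) → Fin q → List (Fin m)
  pathOrder {q} es j =
    map es (reverse (filterᵇ (λ k → toℕ k ℕ.≤ᵇ toℕ j) (allFin q)))
    ++ map es (filterᵇ (λ k → toℕ j ℕ.<ᵇ toℕ k) (allFin q))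

  strategyS : ∀ {q} → Graph → (Fin q → Fin m) → Fin q → Strategy
  strategyS H es j = sequential (pathOrder es j) H

module Submission where

-- Write V(H) for the optimal expected matching size on a
-- residual graph H and Q(H,f) for the value of querying f first and then
-- continuing optimally.  The heart of the argument is an exchange lemma:
-- if an edge e is pendant in H (one endpoint of e meets no other edge of H),
-- then querying e first is optimal, V(H) ≤ Q(H,e).  It is proved by
-- induction on |H|, swapping e with the first query g of an optimal strategy:
-- if g and e are disjoint the two queries commute, and if they share an
-- endpoint the pendant query e is at least as good as g.
--   The edges of a component path P_i meet consecutively at vertices of
-- degree ≤ 2.  Hence in the order e_j, e_{j-1}, …, e_1, e_{j+1}, …, e_q used
-- by S(H,e_j), every edge after the first is pendant once the edges before it
-- have been queried.  So if querying e_j first is optimal, then S(H,e_j)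
-- followed by an optimal strategy on each residual graph is optimal; the
-- contracted decision tree has S(H,e_j) at its root and these optimal
-- strategies as its children (they differ from the root since e_j is gone).

open import Defs
open import Algebra.Bundles using (CommutativeRing)
open import Algebra.Structures using (IsCommutativeRing)
open import Relation.Binary.Structures using (IsPreorder)
import Algebra.Solver.Ring.NaturalCoefficients.Default as NatCoeffSolver
open import Data.Bool using (Bool; true; false; T; if_then_else_)
open import Data.Empty using (⊥; ⊥-elim)
open import Data.Fin as Fin using (Fin; toℕ; inject₁)
open import Data.Fin.Properties using (suc-injective)
open import Data.Fin.Subset using (_⊆_; ∣_∣; inside; outside)
open import Data.Fin.Subset.Properties using (p⊂q⇒∣p∣<∣q∣; p⊆q⇒∣p∣≤∣q∣; ∣p∣≤n)
open import Data.List as List using (List; []; _∷_; _++_; map; allFin; filterᵇ; reverse; length; _∷ʳ_; deduplicate)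
open import Data.List.Properties using (map-tabulate; map-++; map-∘; map-id; map-cong; unfold-reverse; reverse-map; filter-all; filter-none)
open import Data.List.Membership.Propositional using (_∈_; _∉_)
open import Data.List.Membership.Propositional.Properties using (∈-++⁺ˡ; ∈-++⁺ʳ; ∈-++⁻; ∈-deduplicate⁺; ∈-deduplicate⁻; ∈-map⁺; ∈-filter⁺; ∈-allFin)
open import Data.List.Relation.Unary.All as All using (All; universal)
import Data.List.Relation.Unary.All.Properties as AllP
open import Data.List.Relation.Unary.Any using (here; there)
import Data.List.Relation.Unary.Any.Properties as AnyP
open import Data.List.Relation.Unary.Unique.Propositional using (Unique)
open import Data.List.Relation.Unary.Unique.DecPropositional.Properties using (deduplicate-!)
import Data.Nat as ℕ
open import Data.Nat using (ℕ; zero; suc; s≤s; z≤n)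
import Data.Nat.Properties as ℕP
open import Data.Product using (Σ; ∃-syntax; _×_; _,_; proj₁; proj₂)
open import Data.Sum using (_⊎_; inj₁; inj₂; swap)
open import Data.Unit using (tt; ⊤)
open import Data.Vec using (lookup)
open import Data.Vec.Properties using (lookup∘update; lookup∘update′; lookup∘tabulate; []=⇒lookup; lookup⇒[]=)
open import Function using (_∘_; id)
open import Relation.Binary.PropositionalEquality
open import Relation.Nullary using (yes; no; does)
open import Relation.Nullary.Decidable using (T?)

module FieldFacts (ℝ : RealField) where
  open RealField ℝ

  +-identityʳ : ∀ x → x + 0r ≡ x
  +-identityʳ x = trans (+-comm x 0r) (+-identityˡ x)

  +-inverseʳ : ∀ x → x + (- x) ≡ 0r
  +-inverseʳ x = trans (+-comm x (- x)) (+-inverseˡ x)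

  *-identityʳ : ∀ x → x * 1r ≡ x
  *-identityʳ x = trans (*-comm x 1r) (*-identityˡ x)

  distribʳ : ∀ x y z → (y + z) * x ≡ y * x + z * x
  distribʳ x y z =
    trans (*-comm (y + z) x) (trans (distribˡ x y z) (cong₂ _+_ (*-comm x y) (*-comm x z)))

  -- The field as a commutative ring, so that the ring solver applies.
  commutativeRing : CommutativeRing _ _
  commutativeRing = record { isCommutativeRing = isCommutativeRing }
    where
    isCommutativeRing : IsCommutativeRing _≡_ _+_ _*_ -_ 0r 1r
    isCommutativeRing = record
      { isRing = record
        { +-isAbelianGroup = record
          { isGroup = record
            { isMonoid = record
              { isSemigroup = record
                { isMagma = record { isEquivalence = isEquivalence ; ∙-cong = cong₂ _+_ }
                ; assoc = +-assoc }
              ; identity = +-identityˡ , +-identityʳ }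
            ; inverse = +-inverseˡ , +-inverseʳ
            ; ⁻¹-cong = cong (-_) }
          ; comm = +-comm }
        ; *-cong = cong₂ _*_
        ; *-assoc = *-assoc
        ; *-identity = *-identityˡ , *-identityʳ
        ; distrib = distribˡ , distribʳ }
      ; *-comm = *-comm }

  open NatCoeffSolver (CommutativeRing.commutativeSemiring commutativeRing)
    using (solve; _:=_; _:+_; _:*_)

  ≤-reflexive : ∀ {x y} → x ≡ y → x ≤ y
  ≤-reflexive {x} refl = ≤-refl x

  ≤-isPreorder : IsPreorder _≡_ _≤_
  ≤-isPreorder = record { isEquivalence = isEquivalence ; reflexive = ≤-reflexive ; trans = ≤-trans }

  module ≤-Reasoning where
    open import Relation.Binary.Reasoning.Base.Double ≤-isPreorder public
      using (begin_; _∎; step-≡-⟩)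
    open import Relation.Binary.Reasoning.Base.Double ≤-isPreorder using (_IsRelatedTo_; ≲-go)
    open import Relation.Binary.Reasoning.Syntax using (module ≤-syntax)
    open ≤-syntax _IsRelatedTo_ _IsRelatedTo_ ≲-go public

  +-mono-≤ : ∀ {a b c d} → a ≤ b → c ≤ d → a + c ≤ b + d
  +-mono-≤ {a} {b} {c} {d} a≤b c≤d =
    ≤-trans (+-monoˡ-≤ c a≤b)
      (≤-trans (≤-reflexive (+-comm b c)) (≤-trans (+-monoˡ-≤ b c≤d) (≤-reflexive (+-comm d b))))

  x≤y⇒0≤y-x : ∀ {x y} → x ≤ y → 0r ≤ y - x
  x≤y⇒0≤y-x {x} x≤y = ≤-trans (≤-reflexive (sym (+-inverseʳ x))) (+-monoˡ-≤ (- x) x≤y)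

  x+[y-x]≡y : ∀ x y → x + (y - x) ≡ y
  x+[y-x]≡y x y = begin
    x + (y + - x)  ≡⟨ cong (x +_) (+-comm y (- x)) ⟩
    x + (- x + y)  ≡⟨ sym (+-assoc x (- x) y) ⟩
    (x + - x) + y  ≡⟨ cong (_+ y) (+-inverseʳ x) ⟩
    0r + y         ≡⟨ +-identityˡ y ⟩
    y              ∎
    where open ≡-Reasoning

  x≤x+d : ∀ {x d} → 0r ≤ d → x ≤ x + d
  x≤x+d {x} 0≤d = ≤-trans (≤-reflexive (sym (+-identityʳ x))) (+-mono-≤ (≤-refl x) 0≤d)

  *-monoˡ-≤ : ∀ {c x y} → 0r ≤ c → x ≤ y → c * x ≤ c * y
  *-monoˡ-≤ {c} {x} {y} 0≤c x≤y =
    ≤-trans (x≤x+d (*-nonneg 0≤c (x≤y⇒0≤y-x x≤y)))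
      (≤-reflexive (trans (sym (distribˡ c x (y - x))) (cong (c *_) (x+[y-x]≡y x y))))

  -- Expected gain of querying an edge of probability p when the continuation
  -- gains s after a success and f after a failure; expected (query e l r)
  -- is by definition queryValue (p e) (expected r) (expected l).
  queryValue : R → R → R → R
  queryValue p s f = p * (1r + s) + (1r - p) * f

  queryValue-mono : ∀ {p s s′ f f′} → 0r ≤ p → p ≤ 1r → s ≤ s′ → f ≤ f′ →
    queryValue p s f ≤ queryValue p s′ f′
  queryValue-mono 0≤p p≤1 s≤s′ f≤f′ =
    +-mono-≤ (*-monoˡ-≤ 0≤p (+-mono-≤ (≤-refl 1r) s≤s′)) (*-monoˡ-≤ (x≤y⇒0≤y-x p≤1) f≤f′)

  queryValue-nonneg : ∀ {p s f} → 0r ≤ p → p ≤ 1r → 0r ≤ s → 0r ≤ f → 0r ≤ queryValue p s f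
  queryValue-nonneg 0≤p p≤1 0≤s 0≤f =
    ≤-trans (≤-reflexive (sym (+-identityˡ 0r)))
      (+-mono-≤ (*-nonneg 0≤p (≤-trans (≤-reflexive (sym (+-identityˡ 0r))) (+-mono-≤ (≤-trans 0≤p p≤1) 0≤s)))
                (*-nonneg (x≤y⇒0≤y-x p≤1) 0≤f))

  -- The two identities below hold with 1r generalised to U once the
  -- complementary probabilities 1r - e, 1r - g are taken as independent
  -- variables ē, ḡ and e + ē, g + ḡ are inserted where 1r multiplies U.
  private
    commutePoly : ∀ e ē g ḡ a b c d U →
      g * ((e + ē) * U + (e * (U + a) + ē * b)) + ḡ * (e * (U + c) + ē * d)
      ≡ e * ((g + ḡ) * U + (g * (U + a) + ḡ * c)) + ē * (g * (U + b) + ḡ * d)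
    commutePoly = solve 9 (λ e ē g ḡ a b c d U →
      (g :* ((e :+ ē) :* U :+ (e :* (U :+ a) :+ ē :* b)) :+ ḡ :* (e :* (U :+ c) :+ ē :* d))
      := (e :* ((g :+ ḡ) :* U :+ (g :* (U :+ a) :+ ḡ :* c)) :+ ē :* (g :* (U :+ b) :+ ḡ :* d))) refl

    adjacentPoly : ∀ e ē g ḡ B D C U →
      g * ((U + B) * (e + ē)) + ḡ * (e * (U + (B + D)) + ē * C) + e * g * D
      ≡ e * ((U + (B + D)) * (g + ḡ)) + ē * (g * (U + B) + ḡ * C)
    adjacentPoly = solve 8 (λ e ē g ḡ B D C U →
      (g :* ((U :+ B) :* (e :+ ē)) :+ ḡ :* (e :* (U :+ (B :+ D)) :+ ē :* C) :+ e :* g :* D)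
      := (e :* ((U :+ (B :+ D)) :* (g :+ ḡ)) :+ ē :* (g :* (U :+ B) :+ ḡ :* C))) refl

    p+[1-p]≡1 : ∀ p → p + (1r - p) ≡ 1r
    p+[1-p]≡1 p = x+[y-x]≡y p 1r

  -- Two queries whose outcomes do not interact can be performed in either
  -- order: the four continuations a, b, c, d are indexed by the two outcomes.
  queryValue-commute : ∀ e g a b c d →
    queryValue g (queryValue e a b) (queryValue e c d) ≡ queryValue e (queryValue g a c) (queryValue g b d)
  queryValue-commute e g a b c d = begin
    g * (1r + (e * (1r + a) + ē * b)) + ḡ * (e * (1r + c) + ē * d)
      ≡⟨ cong (λ t → g * (t + (e * (1r + a) + ē * b)) + ḡ * (e * (1r + c) + ē * d))
              (sym (trans (*-identityʳ _) (p+[1-p]≡1 e))) ⟩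
    g * ((e + ē) * 1r + (e * (1r + a) + ē * b)) + ḡ * (e * (1r + c) + ē * d)
      ≡⟨ commutePoly e ē g ḡ a b c d 1r ⟩
    e * ((g + ḡ) * 1r + (g * (1r + a) + ḡ * c)) + ē * (g * (1r + b) + ḡ * d)
      ≡⟨ cong (λ t → e * (t + (g * (1r + a) + ḡ * c)) + ē * (g * (1r + b) + ḡ * d))
              (trans (*-identityʳ _) (p+[1-p]≡1 g)) ⟩
    e * (1r + (g * (1r + a) + ḡ * c)) + ē * (g * (1r + b) + ḡ * d) ∎
    where
    open ≡-Reasoning
    ē = 1r - e
    ḡ = 1r - g

  queryValue-adjacent-gap : ∀ e g B D C →
    queryValue g B (queryValue e (B + D) C) + e * g * D ≡ queryValue e (B + D) (queryValue g B C)
  queryValue-adjacent-gap e g B D C = begin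
    g * (1r + B) + ḡ * (e * (1r + (B + D)) + ē * C) + e * g * D
      ≡⟨ cong (λ t → g * t + ḡ * (e * (1r + (B + D)) + ē * C) + e * g * D) (sym (times-one e (1r + B))) ⟩
    g * ((1r + B) * (e + ē)) + ḡ * (e * (1r + (B + D)) + ē * C) + e * g * D
      ≡⟨ adjacentPoly e ē g ḡ B D C 1r ⟩
    e * ((1r + (B + D)) * (g + ḡ)) + ē * (g * (1r + B) + ḡ * C)
      ≡⟨ cong (λ t → e * t + ē * (g * (1r + B) + ḡ * C)) (times-one g (1r + (B + D))) ⟩
    e * (1r + (B + D)) + ē * (g * (1r + B) + ḡ * C) ∎
    where
    open ≡-Reasoning
    ē = 1r - e
    ḡ = 1r - g
    times-one : ∀ p x → x * (p + (1r - p)) ≡ x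
    times-one p x = trans (cong (x *_) (p+[1-p]≡1 p)) (*-identityʳ x)

  queryValue-adjacent : ∀ {e g A B} C → 0r ≤ e → 0r ≤ g → B ≤ A →
    queryValue g B (queryValue e A C) ≤ queryValue e A (queryValue g B C)
  queryValue-adjacent {e} {g} {A} {B} C 0≤e 0≤g B≤A =
    subst (λ t → queryValue g B (queryValue e t C) ≤ queryValue e t (queryValue g B C)) (x+[y-x]≡y B A)
      (≤-trans (x≤x+d (*-nonneg (*-nonneg 0≤e 0≤g) (x≤y⇒0≤y-x B≤A)))
               (≤-reflexive (queryValue-adjacent-gap e g B (A - B) C)))

module ResidualGraphs {ℝ : RealField} (G : WGraph ℝ) where
  open WGraph G

  Incident : Fin n → Fin m → Set
  Incident v h = proj₁ (ends h) ≡ v ⊎ proj₂ (ends h) ≡ v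

  incidentᵇ-sound : ∀ v h → incidentᵇ G v h ≡ true → Incident v h
  incidentᵇ-sound v h eq with proj₁ (ends h) Fin.≟ v | proj₂ (ends h) Fin.≟ v
  ... | yes a | _     = inj₁ a
  ... | no _  | yes b = inj₂ b

  incidentᵇ-complete : ∀ v h → Incident v h → incidentᵇ G v h ≡ true
  incidentᵇ-complete v h inc with proj₁ (ends h) Fin.≟ v | proj₂ (ends h) Fin.≟ v | inc
  ... | yes _ | _     | _      = refl
  ... | no _  | yes _ | _      = refl
  ... | no ¬a | no _  | inj₁ a = ⊥-elim (¬a a)
  ... | no _  | no ¬b | inj₂ b = ⊥-elim (¬b b)

  incident-subst : ∀ {a b h} → a ≡ b → Incident a h → Incident b h
  incident-subst refl inc = inc

  other-endpoint-unique : ∀ {e a b w} → Incident a e → Incident b e → Incident w e →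
    a ≢ w → b ≢ w → a ≡ b
  other-endpoint-unique (inj₁ x) (inj₁ y) _ _ _ = trans (sym x) y
  other-endpoint-unique (inj₂ x) (inj₂ y) _ _ _ = trans (sym x) y
  other-endpoint-unique (inj₁ x) (inj₂ y) (inj₁ z) a≢w _ = ⊥-elim (a≢w (trans (sym x) z))
  other-endpoint-unique (inj₁ x) (inj₂ y) (inj₂ z) _ b≢w = ⊥-elim (b≢w (trans (sym y) z))
  other-endpoint-unique (inj₂ x) (inj₁ y) (inj₁ z) _ b≢w = ⊥-elim (b≢w (trans (sym y) z))
  other-endpoint-unique (inj₂ x) (inj₁ y) (inj₂ z) a≢w _ = ⊥-elim (a≢w (trans (sym x) z))

  ShareEnd : Fin m → Fin m → Set
  ShareEnd e f = ∃[ v ] Incident v e × Incident v f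

  shareEndᵇ-sound : ∀ e f → shareEndᵇ G e f ≡ true → ShareEnd e f
  shareEndᵇ-sound e f eq with incidentᵇ G (proj₁ (ends e)) f in eq₁
  ... | true  = proj₁ (ends e) , inj₁ refl , incidentᵇ-sound _ f eq₁
  ... | false = proj₂ (ends e) , inj₂ refl , incidentᵇ-sound _ f eq

  shareEndᵇ-complete : ∀ e f → ShareEnd e f → shareEndᵇ G e f ≡ true
  shareEndᵇ-complete e f (v , inj₁ refl , inc) rewrite incidentᵇ-complete v f inc = refl
  shareEndᵇ-complete e f (v , inj₂ refl , inc) rewrite incidentᵇ-complete v f inc
    with incidentᵇ G (proj₁ (ends e)) f
  ... | true  = refl
  ... | false = refl

  shareEndᵇ-refl : ∀ e → shareEndᵇ G e e ≡ true
  shareEndᵇ-refl e = shareEndᵇ-complete e e (proj₁ (ends e) , inj₁ refl , inj₁ refl)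

  shareEndᵇ-sym-false : ∀ e f → shareEndᵇ G e f ≡ false → shareEndᵇ G f e ≡ false
  shareEndᵇ-sym-false e f eq with shareEndᵇ G f e in eq′
  ... | false = refl
  ... | true with shareEndᵇ-sound f e eq′
  ...   | v , vf , ve = trans (sym (shareEndᵇ-complete e f (v , ve , vf))) eq

  true≢false : true ≢ false
  true≢false ()

  delEdge-⊆ : ∀ H e h → lookup (delEdge G H e) h ≡ true → (h ≢ e) × (lookup H h ≡ true)
  delEdge-⊆ H e h eq with h Fin.≟ e
  ... | yes refl = ⊥-elim (true≢false (trans (sym eq) (lookup∘update h H outside)))
  ... | no h≢e   = h≢e , trans (sym (lookup∘update′ h≢e H outside)) eq

  delEdge-keep : ∀ H e h → h ≢ e → lookup H h ≡ true → lookup (delEdge G H e) h ≡ true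
  delEdge-keep H e h h≢e eq = trans (lookup∘update′ h≢e H outside) eq

  delEdge-removes : ∀ H e → lookup (delEdge G H e) e ≡ false
  delEdge-removes H e = lookup∘update e H outside

  delEdge-absent : ∀ H e h → lookup H h ≡ false → lookup (delEdge G H e) h ≡ false
  delEdge-absent H e h eq with h Fin.≟ e
  ... | yes refl = delEdge-removes H e
  ... | no h≢e   = trans (lookup∘update′ h≢e H outside) eq

  delNbr-lookup : ∀ H e h → lookup (delNbr G H e) h ≡ (if shareEndᵇ G e h then outside else lookup H h)
  delNbr-lookup H e h = lookup∘tabulate _ h

  delNbr-⊆ : ∀ H e h → lookup (delNbr G H e) h ≡ true → (shareEndᵇ G e h ≡ false) × (lookup H h ≡ true)
  delNbr-⊆ H e h eq with shareEndᵇ G e h | delNbr-lookup H e h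
  ... | true  | r = ⊥-elim (true≢false (trans (sym eq) r))
  ... | false | r = refl , trans (sym r) eq

  delNbr-keep : ∀ H e h → shareEndᵇ G e h ≡ false → lookup H h ≡ true → lookup (delNbr G H e) h ≡ true
  delNbr-keep H e h s eq =
    trans (delNbr-lookup H e h) (trans (cong (λ b → if b then outside else lookup H h) s) eq)

  delNbr-absent : ∀ H e h → lookup H h ≡ false → lookup (delNbr G H e) h ≡ false
  delNbr-absent H e h eq with shareEndᵇ G e h | delNbr-lookup H e h
  ... | true  | r = r
  ... | false | r = trans r eq

  delNbr-removes : ∀ H e → lookup (delNbr G H e) e ≡ false
  delNbr-removes H e =
    trans (delNbr-lookup H e e) (cong (λ b → if b then outside else lookup H e) (shareEndᵇ-refl e))

  -- Edge inclusion between residual graphs (a record, so that both graphs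
  -- can be inferred from an inclusion proof).
  infix 4 _⊑_
  record _⊑_ (H′ H : Graph G) : Set where
    constructor mk⊑
    field ⊑-member : ∀ h → lookup H′ h ≡ true → lookup H h ≡ true
  open _⊑_ public

  delEdge-⊑ : ∀ H e → delEdge G H e ⊑ H
  delEdge-⊑ H e = mk⊑ λ h eq → proj₂ (delEdge-⊆ H e h eq)

  delNbr-⊑ : ∀ H e → delNbr G H e ⊑ H
  delNbr-⊑ H e = mk⊑ λ h eq → proj₂ (delNbr-⊆ H e h eq)

  delNbr-⊑-delEdge : ∀ H e → delNbr G H e ⊑ delEdge G H e
  delNbr-⊑-delEdge H e = mk⊑ λ h eq →
    let (e≁h , h∈H) = delNbr-⊆ H e h eq
    in delEdge-keep H e h (λ { refl → true≢false (trans (sym (shareEndᵇ-refl e)) e≁h) }) h∈H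

  delEdge-mono : ∀ {H′ H} e → H′ ⊑ H → delEdge G H′ e ⊑ delEdge G H e
  delEdge-mono {H′} {H} e H′⊑H = mk⊑ λ h eq →
    let (h≢e , h∈H′) = delEdge-⊆ H′ e h eq
    in delEdge-keep H e h h≢e (⊑-member H′⊑H h h∈H′)

  delNbr-mono : ∀ {H′ H} e → H′ ⊑ H → delNbr G H′ e ⊑ delNbr G H e
  delNbr-mono {H′} {H} e H′⊑H = mk⊑ λ h eq →
    let (e≁h , h∈H′) = delNbr-⊆ H′ e h eq
    in delNbr-keep H e h e≁h (⊑-member H′⊑H h h∈H′)

  delNbr-delNbr : ∀ H g e → delNbr G (delNbr G H g) e ⊑ delNbr G (delNbr G H e) g
  delNbr-delNbr H g e = mk⊑ λ h eq →
    let (e≁h , h∈H∖Ng) = delNbr-⊆ (delNbr G H g) e h eq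
        (g≁h , h∈H)    = delNbr-⊆ H g h h∈H∖Ng
    in delNbr-keep (delNbr G H e) g h g≁h (delNbr-keep H e h e≁h h∈H)

  delEdge-delNbr : ∀ H g e → delEdge G (delNbr G H g) e ⊑ delNbr G (delEdge G H e) g
  delEdge-delNbr H g e = mk⊑ λ h eq →
    let (h≢e , h∈H∖Ng) = delEdge-⊆ (delNbr G H g) e h eq
        (g≁h , h∈H)    = delNbr-⊆ H g h h∈H∖Ng
    in delNbr-keep (delEdge G H e) g h g≁h (delEdge-keep H e h h≢e h∈H)

  delNbr-delEdge : ∀ H g e → delNbr G (delEdge G H g) e ⊑ delEdge G (delNbr G H e) g
  delNbr-delEdge H g e = mk⊑ λ h eq →
    let (e≁h , h∈H∖g) = delNbr-⊆ (delEdge G H g) e h eq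
        (h≢g , h∈H)   = delEdge-⊆ H g h h∈H∖g
    in delEdge-keep (delNbr G H e) g h h≢g (delNbr-keep H e h e≁h h∈H)

  delEdge-delEdge : ∀ H g e → delEdge G (delEdge G H g) e ⊑ delEdge G (delEdge G H e) g
  delEdge-delEdge H g e = mk⊑ λ h eq →
    let (h≢e , h∈H∖g) = delEdge-⊆ (delEdge G H g) e h eq
        (h≢g , h∈H)   = delEdge-⊆ H g h h∈H∖g
    in delEdge-keep (delEdge G H e) g h h≢g (delEdge-keep H e h h≢e h∈H)

  -- If g shares an endpoint with e, a success of g also removes e.
  delNbr-⊑-delNbr-delEdge : ∀ H e g → shareEndᵇ G g e ≡ true → delNbr G H g ⊑ delNbr G (delEdge G H e) g
  delNbr-⊑-delNbr-delEdge H e g g∼e = mk⊑ λ h eq →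
    let (g≁h , h∈H) = delNbr-⊆ H g h eq
    in delNbr-keep (delEdge G H e) g h g≁h
         (delEdge-keep H e h (λ { refl → true≢false (trans (sym g∼e) g≁h) }) h∈H)

  valid-mono : ∀ S {H′ H} → H′ ⊑ H → Valid G S H′ → Valid G S H
  valid-mono leaf _ _ = tt
  valid-mono (query e l r) H′⊑H (e∈H′ , valid-l , valid-r) =
    ⊑-member H′⊑H e e∈H′ , valid-mono l (delEdge-mono e H′⊑H) valid-l , valid-mono r (delNbr-mono e H′⊑H) valid-r

  ⊑⇒⊆ : ∀ {H′ H} → H′ ⊑ H → H′ ⊆ H
  ⊑⇒⊆ {H′} {H} H′⊑H {x} x∈H′ = lookup⇒[]= x H (⊑-member H′⊑H x ([]=⇒lookup x∈H′))

  size-mono : ∀ {H′ H} → H′ ⊑ H → ∣ H′ ∣ ℕ.≤ ∣ H ∣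
  size-mono {H′} {H} H′⊑H = p⊆q⇒∣p∣≤∣q∣ {p = H′} {q = H} (⊑⇒⊆ H′⊑H)

  size-delEdge : ∀ H e → lookup H e ≡ true → ∣ delEdge G H e ∣ ℕ.< ∣ H ∣
  size-delEdge H e e∈H = p⊂q⇒∣p∣<∣q∣ {p = delEdge G H e} {q = H}
    (⊑⇒⊆ (delEdge-⊑ H e) , e , lookup⇒[]= e H e∈H ,
     λ e∈H∖e → true≢false (trans (sym ([]=⇒lookup e∈H∖e)) (delEdge-removes H e)))

  size-delNbr : ∀ H e → lookup H e ≡ true → ∣ delNbr G H e ∣ ℕ.< ∣ H ∣
  size-delNbr H e e∈H = ℕP.≤-<-trans (size-mono (delNbr-⊑-delEdge H e)) (size-delEdge H e e∈H)

  size-zero-empty : ∀ H → ∣ H ∣ ℕ.≤ 0 → ∀ f → lookup H f ≡ true → ⊥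
  size-zero-empty H |H|≤0 f f∈H = ℕP.n≮0 (ℕP.<-≤-trans (size-delEdge H f f∈H) |H|≤0)

module OptimalValue {ℝ : RealField} (G : WGraph ℝ) where
  open RealField ℝ
  open WGraph G
  open FieldFacts ℝ
  open ResidualGraphs G

  0≤p : ∀ f → 0r ≤ p f
  0≤p f = proj₁ (p-pos f)

  OptimalFor : Graph G → Set
  OptimalFor H = Σ (Strategy G) λ S → Optimal G S H

  -- One step of the recursion: from optimal strategies for all residual
  -- graphs after the first query, pick the best first query of H (or none).
  module BestFirstQuery (H : Graph G)
      (optFail    : ∀ f → lookup H f ≡ true → OptimalFor (delEdge G H f))
      (optSuccess : ∀ f → lookup H f ≡ true → OptimalFor (delNbr G H f)) where

    candidate : ∀ f → lookup H f ≡ true → Strategy G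
    candidate f f∈H = query f (proj₁ (optFail f f∈H)) (proj₁ (optSuccess f f∈H))

    candidate-valid : ∀ f f∈H → Valid G (candidate f f∈H) H
    candidate-valid f f∈H = f∈H , proj₁ (proj₂ (optFail f f∈H)) , proj₁ (proj₂ (optSuccess f f∈H))

    candidate-best : ∀ f f∈H l r → Valid G (query f l r) H →
      expected G (query f l r) ≤ expected G (candidate f f∈H)
    candidate-best f f∈H l r (_ , valid-l , valid-r) =
      queryValue-mono (0≤p f) (p-≤1 f) (proj₂ (proj₂ (optSuccess f f∈H)) r valid-r)
                                       (proj₂ (proj₂ (optFail f f∈H)) l valid-l)

    Best : List (Fin m) → Strategy G → Set
    Best fs acc = Σ (Strategy G) λ S → Valid G S H × (expected G acc ≤ expected G S) ×
      (∀ f → f ∈ fs → ∀ l r → Valid G (query f l r) H → expected G (query f l r) ≤ expected G S)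

    scan : ∀ fs acc → Valid G acc H → Best fs acc
    scan [] acc valid = acc , valid , ≤-refl _ , λ _ ()
    scan (f ∷ fs) acc valid with lookup H f in f∈H
    ... | false =
      let (S , valid-S , acc≤S , best) = scan fs acc valid
      in S , valid-S , acc≤S , λ where
           _ (here refl) l r (f∈H′ , _) → ⊥-elim (true≢false (trans (sym f∈H′) f∈H))
           f′ (there f′∈fs) → best f′ f′∈fs
    ... | true with ≤-total (expected G acc) (expected G (candidate f f∈H))
    ...   | inj₁ acc≤cand =
      let (S , valid-S , cand≤S , best) = scan fs (candidate f f∈H) (candidate-valid f f∈H)
      in S , valid-S , ≤-trans acc≤cand cand≤S , λ where
           _ (here refl) l r v → ≤-trans (candidate-best f f∈H l r v) cand≤S
           f′ (there f′∈fs) → best f′ f′∈fs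
    ...   | inj₂ cand≤acc =
      let (S , valid-S , acc≤S , best) = scan fs acc valid
      in S , valid-S , acc≤S , λ where
           _ (here refl) l r v → ≤-trans (candidate-best f f∈H l r v) (≤-trans cand≤acc acc≤S)
           f′ (there f′∈fs) → best f′ f′∈fs

    optimal : OptimalFor H
    optimal =
      let (S , valid-S , leaf≤S , best) = scan (allFin m) leaf tt
      in S , valid-S , λ where
           leaf _ → leaf≤S
           (query f l r) v → best f (∈-allFin f) l r v

  optimal-exists : ∀ k H → ∣ H ∣ ℕ.≤ k → OptimalFor H
  optimal-exists zero H |H|≤0 = leaf , tt , λ where
    leaf _ → ≤-refl _
    (query f l r) (f∈H , _) → ⊥-elim (size-zero-empty H |H|≤0 f f∈H)
  optimal-exists (suc k) H |H|≤1+k = BestFirstQuery.optimal H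
    (λ f f∈H → optimal-exists k (delEdge G H f) (ℕP.<⇒≤pred (ℕP.<-≤-trans (size-delEdge H f f∈H) |H|≤1+k)))
    (λ f f∈H → optimal-exists k (delNbr G H f) (ℕP.<⇒≤pred (ℕP.<-≤-trans (size-delNbr H f f∈H) |H|≤1+k)))

  opt : Graph G → Strategy G
  opt H = proj₁ (optimal-exists m H (∣p∣≤n H))

  opt-optimal : ∀ H → Optimal G (opt H) H
  opt-optimal H = proj₂ (optimal-exists m H (∣p∣≤n H))

  V : Graph G → R
  V H = expected G (opt H)

  Q : Graph G → Fin m → R
  Q H f = queryValue (p f) (V (delNbr G H f)) (V (delEdge G H f))

  V-max : ∀ S H → Valid G S H → expected G S ≤ V H
  V-max S H valid = proj₂ (opt-optimal H) S valid

  V-nonneg : ∀ H → 0r ≤ V H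
  V-nonneg H = V-max leaf H tt

  V-mono : ∀ {H′ H} → H′ ⊑ H → V H′ ≤ V H
  V-mono {H′} {H} H′⊑H = V-max (opt H′) H (valid-mono (opt H′) H′⊑H (proj₁ (opt-optimal H′)))

  Q-nonneg : ∀ H f → 0r ≤ Q H f
  Q-nonneg H f = queryValue-nonneg (0≤p f) (p-≤1 f) (V-nonneg (delNbr G H f)) (V-nonneg (delEdge G H f))

  Q≤V : ∀ H f → lookup H f ≡ true → Q H f ≤ V H
  Q≤V H f f∈H = V-max (query f (opt (delEdge G H f)) (opt (delNbr G H f))) H
    (f∈H , proj₁ (opt-optimal (delEdge G H f)) , proj₁ (opt-optimal (delNbr G H f)))

  expected≤Q : ∀ H f l r → Valid G (query f l r) H → expected G (query f l r) ≤ Q H f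
  expected≤Q H f l r (_ , valid-l , valid-r) =
    queryValue-mono (0≤p f) (p-≤1 f) (V-max r (delNbr G H f) valid-r) (V-max l (delEdge G H f) valid-l)

  V-first-query : ∀ H → (V H ≤ 0r) ⊎ (∃[ g ] lookup H g ≡ true × V H ≤ Q H g)
  V-first-query H with opt H | opt-optimal H
  ... | leaf        | _           = inj₁ (≤-refl _)
  ... | query g l r | (valid , _) = inj₂ (g , proj₁ valid , expected≤Q H g l r valid)

  optimal-first-query : ∀ H f l r → Optimal G (query f l r) H → V H ≤ Q H f
  optimal-first-query H f l r (valid , best) =
    ≤-trans (best (opt H) (proj₁ (opt-optimal H))) (expected≤Q H f l r valid)

module PendantExchange {ℝ : RealField} (G : WGraph ℝ) where
  open RealField ℝ
  open WGraph G
  open FieldFacts ℝ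
  open ResidualGraphs G
  open OptimalValue G

  Pendant : Graph G → Fin m → Set
  Pendant H e = ∃[ w ] Incident w e × (∀ h → lookup H h ≡ true → Incident w h → h ≡ e)

  pendant-⊑ : ∀ {H′ H e} → H′ ⊑ H → Pendant H e → Pendant H′ e
  pendant-⊑ H′⊑H (w , w∈e , only-e) = w , w∈e , λ h h∈H′ → only-e h (⊑-member H′⊑H h h∈H′)

  -- An edge g ≠ e of H touching the pendant edge e avoids its pendant
  -- endpoint, so it meets e at the other endpoint: a success of g removes
  -- every edge that a success of e removes.
  delNbr-pendant : ∀ H e g → Pendant H e → lookup H g ≡ true → g ≢ e → shareEndᵇ G g e ≡ true →
    delNbr G H g ⊑ delNbr G H e
  delNbr-pendant H e g (w , w∈e , only-e) g∈H g≢e g∼e = mk⊑ λ h h∈H∖Ng →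
    let (g≁h , h∈H) = delNbr-⊆ H g h h∈H∖Ng
    in delNbr-keep H e h (e≁h h h∈H g≁h) h∈H
    where
    e≁h : ∀ h → lookup H h ≡ true → shareEndᵇ G g h ≡ false → shareEndᵇ G e h ≡ false
    e≁h h h∈H g≁h with shareEndᵇ G e h in e∼h
    ... | false = refl
    ... | true with shareEndᵇ-sound e h e∼h | shareEndᵇ-sound g e g∼e
    ...   | v , v∈e , v∈h | x , x∈g , x∈e with v Fin.≟ w | x Fin.≟ w
    ...     | yes refl | _ =
      ⊥-elim (true≢false (trans (sym (subst (λ f → shareEndᵇ G g f ≡ true) (sym (only-e h h∈H v∈h)) g∼e)) g≁h))
    ...     | no _ | yes refl = ⊥-elim (g≢e (only-e g g∈H x∈g))
    ...     | no v≢w | no x≢w =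
      ⊥-elim (true≢false (trans (sym (shareEndᵇ-complete g h
        (x , x∈g , incident-subst (other-endpoint-unique v∈e x∈e w∈e v≢w x≢w) v∈h))) g≁h))

  exchange-disjoint : ∀ H e g → lookup H g ≡ true → g ≢ e → shareEndᵇ G g e ≡ false →
    V (delNbr G H g) ≤ Q (delNbr G H g) e → V (delEdge G H g) ≤ Q (delEdge G H g) e →
    Q H g ≤ Q H e
  exchange-disjoint H e g g∈H g≢e g≁e IH-success IH-fail = begin
    qg (V Ng) (V ∖g)
      ≤⟨ queryValue-mono (0≤p g) (p-≤1 g) IH-success IH-fail ⟩
    qg (qe (V (delNbr G Ng e)) (V (delEdge G Ng e))) (qe (V (delNbr G ∖g e)) (V (delEdge G ∖g e)))
      ≤⟨ queryValue-mono (0≤p g) (p-≤1 g)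
           (queryValue-mono (0≤p e) (p-≤1 e) (V-mono (delNbr-delNbr H g e)) (V-mono (delEdge-delNbr H g e)))
           (queryValue-mono (0≤p e) (p-≤1 e) (V-mono (delNbr-delEdge H g e)) (V-mono (delEdge-delEdge H g e))) ⟩
    qg (qe (V (delNbr G Ne g)) (V (delNbr G ∖e g))) (qe (V (delEdge G Ne g)) (V (delEdge G ∖e g)))
      ≡⟨ queryValue-commute (p e) (p g) _ _ _ _ ⟩
    qe (Q Ne g) (Q ∖e g)
      ≤⟨ queryValue-mono (0≤p e) (p-≤1 e)
           (Q≤V Ne g (delNbr-keep H e g (shareEndᵇ-sym-false g e g≁e) g∈H))
           (Q≤V ∖e g (delEdge-keep H e g g≢e g∈H)) ⟩
    qe (V Ne) (V ∖e) ∎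
    where
    open ≤-Reasoning
    qe = queryValue (p e)
    qg = queryValue (p g)
    Ne = delNbr G H e
    Ng = delNbr G H g
    ∖e = delEdge G H e
    ∖g = delEdge G H g

  exchange-adjacent : ∀ H e g → Pendant H e → lookup H g ≡ true → g ≢ e → shareEndᵇ G g e ≡ true →
    V (delEdge G H g) ≤ Q (delEdge G H g) e → Q H g ≤ Q H e
  exchange-adjacent H e g e-pendant g∈H g≢e g∼e IH-fail = begin
    qg (V Ng) (V ∖g)
      ≤⟨ queryValue-mono (0≤p g) (p-≤1 g) (≤-refl _) IH-fail ⟩
    qg (V Ng) (qe (V (delNbr G ∖g e)) (V (delEdge G ∖g e)))
      ≤⟨ queryValue-mono (0≤p g) (p-≤1 g) (≤-refl _)
           (queryValue-mono (0≤p e) (p-≤1 e) (V-mono (delNbr-mono e (delEdge-⊑ H g))) (V-mono (delEdge-delEdge H g e))) ⟩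
    qg (V Ng) (qe (V Ne) (V (delEdge G ∖e g)))
      ≤⟨ queryValue-adjacent _ (0≤p e) (0≤p g) (V-mono (delNbr-pendant H e g e-pendant g∈H g≢e g∼e)) ⟩
    qe (V Ne) (qg (V Ng) (V (delEdge G ∖e g)))
      ≤⟨ queryValue-mono (0≤p e) (p-≤1 e) (≤-refl _)
           (queryValue-mono (0≤p g) (p-≤1 g) (V-mono (delNbr-⊑-delNbr-delEdge H e g g∼e)) (≤-refl _)) ⟩
    qe (V Ne) (Q ∖e g)
      ≤⟨ queryValue-mono (0≤p e) (p-≤1 e) (≤-refl _) (Q≤V ∖e g (delEdge-keep H e g g≢e g∈H)) ⟩
    qe (V Ne) (V ∖e) ∎
    where
    open ≤-Reasoning
    qe = queryValue (p e)
    qg = queryValue (p g)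
    Ne = delNbr G H e
    Ng = delNbr G H g
    ∖e = delEdge G H e
    ∖g = delEdge G H g

  -- Main exchange lemma, by induction on the number of edges: compare e
  -- with the first query g of an optimal strategy.
  pendant-first : ∀ k H → ∣ H ∣ ℕ.≤ k → ∀ e → lookup H e ≡ true → Pendant H e → V H ≤ Q H e
  pendant-first zero H |H|≤0 e e∈H _ = ⊥-elim (size-zero-empty H |H|≤0 e e∈H)
  pendant-first (suc k) H |H|≤1+k e e∈H e-pendant with V-first-query H
  ... | inj₁ V≤0 = ≤-trans V≤0 (Q-nonneg H e)
  ... | inj₂ (g , g∈H , V≤Qg) = ≤-trans V≤Qg Qg≤Qe
    where
    shrink : ∀ H′ → ∣ H′ ∣ ℕ.< ∣ H ∣ → ∣ H′ ∣ ℕ.≤ k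
    shrink _ |H′|<|H| = ℕP.<⇒≤pred (ℕP.<-≤-trans |H′|<|H| |H|≤1+k)

    IH-fail : g ≢ e → V (delEdge G H g) ≤ Q (delEdge G H g) e
    IH-fail g≢e = pendant-first k (delEdge G H g) (shrink (delEdge G H g) (size-delEdge H g g∈H)) e
      (delEdge-keep H g e (λ e≡g → g≢e (sym e≡g)) e∈H) (pendant-⊑ (delEdge-⊑ H g) e-pendant)

    IH-success : shareEndᵇ G g e ≡ false → V (delNbr G H g) ≤ Q (delNbr G H g) e
    IH-success g≁e = pendant-first k (delNbr G H g) (shrink (delNbr G H g) (size-delNbr H g g∈H)) e
      (delNbr-keep H g e g≁e e∈H) (pendant-⊑ (delNbr-⊑ H g) e-pendant)

    Qg≤Qe : Q H g ≤ Q H e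
    Qg≤Qe with g Fin.≟ e | shareEndᵇ G g e in g∼e
    ... | yes refl | _     = ≤-refl _
    ... | no g≢e   | false = exchange-disjoint H e g g∈H g≢e g∼e (IH-success g∼e) (IH-fail g≢e)
    ... | no g≢e   | true  = exchange-adjacent H e g e-pendant g∈H g≢e g∼e (IH-fail g≢e)

module SequentialStrategies {ℝ : RealField} (G : WGraph ℝ) where
  open RealField ℝ
  open WGraph G
  open FieldFacts ℝ
  open ResidualGraphs G
  open OptimalValue G
  open PendantExchange G

  PendantAfter : List (Fin m) → Fin m → Set
  PendantAfter done f = ∃[ w ] Incident w f × (∀ h → Incident w h → h ≡ f ⊎ h ∈ done)

  PendantOrder : List (Fin m) → List (Fin m) → Set
  PendantOrder done []       = ⊤
  PendantOrder done (f ∷ fs) = PendantAfter done f × PendantOrder (f ∷ done) fs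

  Avoids : List (Fin m) → Graph G → Set
  Avoids done H = ∀ h → h ∈ done → lookup H h ≡ false

  pendantAfter⇒pendant : ∀ {done f} H → Avoids done H → PendantAfter done f → Pendant H f
  pendantAfter⇒pendant {done} {f} H avoids (w , w∈f , only) = w , w∈f , λ h h∈H w∈h → ≡f (only h w∈h) h∈H
    where
    ≡f : ∀ {h} → h ≡ f ⊎ h ∈ done → lookup H h ≡ true → h ≡ f
    ≡f (inj₁ h≡f) _ = h≡f
    ≡f {h} (inj₂ h∈done) h∈H = ⊥-elim (true≢false (trans (sym h∈H) (avoids h h∈done)))

  avoids-delEdge : ∀ {done} H f → Avoids done H → Avoids (f ∷ done) (delEdge G H f)
  avoids-delEdge H f _      _ (here refl)   = delEdge-removes H f
  avoids-delEdge H f avoids h (there h∈done) = delEdge-absent H f h (avoids h h∈done)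

  avoids-delNbr : ∀ {done} H f → Avoids done H → Avoids (f ∷ done) (delNbr G H f)
  avoids-delNbr H f _      _ (here refl)   = delNbr-removes H f
  avoids-delNbr H f avoids h (there h∈done) = delNbr-absent H f h (avoids h h∈done)

  avoids-absent : ∀ {done f} H → Avoids done H → lookup H f ≡ false → Avoids (f ∷ done) H
  avoids-absent H _      f∉H _ (here refl)    = f∉H
  avoids-absent H avoids _   h (there h∈done) = avoids h h∈done

  sequential-valid : ∀ L H → Valid G (sequential G L H) H
  sequential-valid []       H = tt
  sequential-valid (f ∷ fs) H with lookup H f in f∈H
  ... | true  = f∈H , sequential-valid fs (delEdge G H f) , sequential-valid fs (delNbr G H f)
  ... | false = sequential-valid fs H

  sequential-present : ∀ f fs H → lookup H f ≡ true →
    sequential G (f ∷ fs) H ≡ query f (sequential G fs (delEdge G H f)) (sequential G fs (delNbr G H f))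
  sequential-present f fs H f∈H with lookup H f
  ... | true = refl

  module Grafting (cs : List (CDT G)) where
    GoodContinuation : Graph G → Set
    GoodContinuation H′ = Optimal G (continue G H′ cs) H′

    GraftOptimal : Strategy G → Graph G → Set
    GraftOptimal S H = (∀ H′ → H′ ∈ residuals G S H → GoodContinuation H′) →
      Valid G (graft G S H cs) H × V H ≤ expected G (graft G S H cs)

    graftOptimal-query : ∀ f l r H → lookup H f ≡ true → V H ≤ Q H f →
      GraftOptimal l (delEdge G H f) → GraftOptimal r (delNbr G H f) → GraftOptimal (query f l r) H
    graftOptimal-query f l r H f∈H V≤Q opt-l opt-r good =
      let (valid-l , V≤l) = opt-l (λ H′ x → good H′ (∈-++⁺ˡ x))
          (valid-r , V≤r) = opt-r (λ H′ x → good H′ (∈-++⁺ʳ (residuals G l (delEdge G H f)) x))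
      in (f∈H , valid-l , valid-r) , ≤-trans V≤Q (queryValue-mono (0≤p f) (p-≤1 f) V≤r V≤l)

    -- Every query of a sequential strategy along a pendant order is a
    -- pendant edge, hence an optimal first move.
    graftOptimal-sequential : ∀ L done H → Avoids done H → PendantOrder done L →
      GraftOptimal (sequential G L H) H
    graftOptimal-sequential [] done H _ _ good =
      let (valid , best) = good H (here refl)
      in valid , best (opt H) (proj₁ (opt-optimal H))
    graftOptimal-sequential (f ∷ fs) done H avoids (f-pendant , order) with lookup H f in f∈H
    ... | true = graftOptimal-query f (sequential G fs (delEdge G H f)) (sequential G fs (delNbr G H f)) H f∈H
          (pendant-first m H (∣p∣≤n H) f f∈H (pendantAfter⇒pendant H avoids f-pendant))
          (graftOptimal-sequential fs (f ∷ done) (delEdge G H f) (avoids-delEdge H f avoids) order)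
          (graftOptimal-sequential fs (f ∷ done) (delNbr G H f) (avoids-delNbr H f avoids) order)
    ... | false = graftOptimal-sequential fs (f ∷ done) H (avoids-absent H avoids f∈H) order

    graftOptimal-sequential-root : ∀ f fs H → lookup H f ≡ true → V H ≤ Q H f →
      PendantOrder (f ∷ []) fs → GraftOptimal (sequential G (f ∷ fs) H) H
    graftOptimal-sequential-root f fs H f∈H V≤Q order
      rewrite sequential-present f fs H f∈H =
      graftOptimal-query f (sequential G fs (delEdge G H f)) (sequential G fs (delNbr G H f)) H f∈H V≤Q
        (graftOptimal-sequential fs (f ∷ []) (delEdge G H f) (avoids-delEdge H f (λ _ ())) order)
        (graftOptimal-sequential fs (f ∷ []) (delNbr G H f) (avoids-delNbr H f (λ _ ())) order)

-- A two-level contracted decision tree: a given root strategy whose leaves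
-- are continued by optimal strategies.
module CDTConstruction {ℝ : RealField} (G : WGraph ℝ) where
  open RealField ℝ
  open WGraph G
  open ResidualGraphs G
  open OptimalValue G
  open SequentialStrategies G

  dedup : List (Graph G) → List (Graph G)
  dedup = deduplicate (_≟G_ G)

  leaves : List (Graph G) → List (CDT G)
  leaves = map cleaf

  child : Graph G → CDT G
  child H′ = cnode H′ (opt H′) (leaves (dedup (residuals G (opt H′) H′)))

  continue-leaves : ∀ X D → continue G X (leaves D) ≡ leaf
  continue-leaves X []      = refl
  continue-leaves X (d ∷ D) with does (_≟G_ G d X)
  ... | true  = refl
  ... | false = continue-leaves X D

  graft-leaves : ∀ S X D → graft G S X (leaves D) ≡ S
  graft-leaves leaf          X D = continue-leaves X D
  graft-leaves (query e l r) X D = cong₂ (query e) (graft-leaves l _ D) (graft-leaves r _ D)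

  continue-children : ∀ D H′ → H′ ∈ D → continue G H′ (map child D) ≡ opt H′
  continue-children (d ∷ D) H′ H′∈D with _≟G_ G d H′ | H′∈D
  ... | yes refl | _            = graft-leaves (opt d) d _
  ... | no d≢H′  | here H′≡d    = ⊥-elim (d≢H′ (sym H′≡d))
  ... | no _     | there H′∈D′  = continue-children D H′ H′∈D′

  graphOf-map : ∀ (f : Graph G → CDT G) → (∀ H′ → graphOf G (f H′) ≡ H′) → ∀ D → map (graphOf G) (map f D) ≡ D
  graphOf-map f graphOf-f D = trans (sym (map-∘ D)) (trans (map-cong graphOf-f D) (map-id D))

  wf-dedup : ∀ {ancestors H S} → Valid G S H → S ∉ ancestors →
    (cs : List (CDT G)) → map (graphOf G) cs ≡ dedup (residuals G S H) → All (WF G (S ∷ ancestors)) cs →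
    WF G ancestors (cnode H S cs)
  wf-dedup {H = H} {S} valid S∉ancestors cs graphs≡ wf-cs = wf-node valid S∉ancestors
    (subst Unique (sym graphs≡) (deduplicate-! (_≟G_ G) _))
    (λ H′ x → ∈-deduplicate⁻ (_≟G_ G) (residuals G S H) (subst (H′ ∈_) graphs≡ x))
    (λ H′ x → subst (H′ ∈_) (sym graphs≡) (∈-deduplicate⁺ (_≟G_ G) x))
    wf-cs

  residuals-absent : ∀ S H f H′ → lookup H f ≡ false → H′ ∈ residuals G S H → lookup H′ f ≡ false
  residuals-absent leaf          H f H′ f∉H (here refl) = f∉H
  residuals-absent (query e l r) H f H′ f∉H x with ∈-++⁻ (residuals G l (delEdge G H e)) x
  ... | inj₁ y = residuals-absent l _ f H′ (delEdge-absent H e f f∉H) y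
  ... | inj₂ y = residuals-absent r _ f H′ (delNbr-absent H e f f∉H) y

  residuals-query : ∀ f l r H H′ → H′ ∈ residuals G (query f l r) H → lookup H′ f ≡ false
  residuals-query f l r H H′ x with ∈-++⁻ (residuals G l (delEdge G H f)) x
  ... | inj₁ y = residuals-absent l _ f H′ (delEdge-removes H f) y
  ... | inj₂ y = residuals-absent r _ f H′ (delNbr-removes H f) y

  -- A child for a graph without f differs from a root strategy querying f
  -- first, since an optimal strategy only queries edges that are present.
  child-wf : ∀ f l r H′ → lookup H′ f ≡ false → WF G (query f l r ∷ []) (child H′)
  child-wf f l r H′ f∉H′ = wf-dedup (proj₁ (opt-optimal H′)) opt≢root _
    (graphOf-map cleaf (λ _ → refl) _) (AllP.map⁺ (universal wf-leaf _))
    where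
    opt≢root : opt H′ ∉ (query f l r ∷ [])
    opt≢root (here opt≡root) =
      true≢false (trans (sym (proj₁ (subst (λ T → Valid G T H′) opt≡root (proj₁ (opt-optimal H′))))) f∉H′)

  optimalCDT-sequential : ∀ f fs H → lookup H f ≡ true → V H ≤ Q H f → PendantOrder (f ∷ []) fs →
    ∃[ cs ] OptimalCDT G (cnode H (sequential G (f ∷ fs) H) cs) H
  optimalCDT-sequential f fs H f∈H V≤Q order =
    cs , (refl , wf-root) , (proj₁ optimal , λ S′ valid → ≤-trans (V-max S′ H valid) (proj₂ optimal))
    where
    S  = sequential G (f ∷ fs) H
    D  = dedup (residuals G S H)
    cs = map child D
    onFail    = sequential G fs (delEdge G H f)
    onSuccess = sequential G fs (delNbr G H f)
    root      = query f onFail onSuccess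
    open Grafting cs

    good : ∀ H′ → H′ ∈ residuals G S H → GoodContinuation H′
    good H′ x = subst (λ T → Optimal G T H′)
      (sym (continue-children D H′ (∈-deduplicate⁺ (_≟G_ G) x))) (opt-optimal H′)

    optimal = graftOptimal-sequential-root f fs H f∈H V≤Q order good

    children-wf : ∀ D′ → (∀ H′ → H′ ∈ D′ → lookup H′ f ≡ false) → All (WF G (root ∷ [])) (map child D′)
    children-wf D′ f∉D′ = AllP.map⁺ (All.tabulate λ {H′} H′∈D′ → child-wf f onFail onSuccess H′ (f∉D′ H′ H′∈D′))

    f∉D : ∀ H′ → H′ ∈ D → lookup H′ f ≡ false
    f∉D H′ x = residuals-query f onFail onSuccess H H′
      (subst (λ T → H′ ∈ residuals G T H) (sequential-present f fs H f∈H) (∈-deduplicate⁻ (_≟G_ G) (residuals G S H) x))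

    wf-root : WF G [] (cnode H S cs)
    wf-root = wf-dedup (sequential-valid (f ∷ fs) H) (λ ()) cs (graphOf-map child (λ _ → refl) D)
      (subst (λ T → All (WF G (T ∷ [])) cs) (sym (sequential-present f fs H f∈H)) (children-wf D f∉D))

upTo : ∀ {q} → Fin q → List (Fin q)
upTo Fin.zero    = Fin.zero ∷ []
upTo (Fin.suc j) = Fin.zero ∷ map Fin.suc (upTo j)

below : ∀ {q} → Fin q → List (Fin q)
below Fin.zero    = []
below (Fin.suc j) = map Fin.suc (below j) ∷ʳ Fin.zero

above : ∀ {q} → Fin q → List (Fin q)
above {suc q} Fin.zero = List.tabulate Fin.suc
above (Fin.suc j)      = map Fin.suc (above j)

filterᵇ-map : ∀ {A B : Set} (P : B → Bool) (f : A → B) xs →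
  filterᵇ P (map f xs) ≡ map f (filterᵇ (P ∘ f) xs)
filterᵇ-map P f []       = refl
filterᵇ-map P f (x ∷ xs) with P (f x)
... | true  = cong (f x ∷_) (filterᵇ-map P f xs)
... | false = filterᵇ-map P f xs

filterᵇ-cong : ∀ {A : Set} {P P′ : A → Bool} → (∀ x → P x ≡ P′ x) → ∀ xs → filterᵇ P xs ≡ filterᵇ P′ xs
filterᵇ-cong             P≗P′ []       = refl
filterᵇ-cong {P = P} {P′} P≗P′ (x ∷ xs) with P x | P′ x | P≗P′ x
... | true  | true  | _ = cong (x ∷_) (filterᵇ-cong P≗P′ xs)
... | false | false | _ = filterᵇ-cong P≗P′ xs

filterᵇ-shift : ∀ {q} (P : Fin (suc q) → Bool) →
  filterᵇ P (List.tabulate Fin.suc) ≡ map Fin.suc (filterᵇ (P ∘ Fin.suc) (allFin q))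
filterᵇ-shift {q} P = trans (cong (filterᵇ P) (sym (map-tabulate id Fin.suc))) (filterᵇ-map P Fin.suc (allFin q))

<ᵇ-suc : ∀ a b → (a ℕ.<ᵇ suc b) ≡ (a ℕ.≤ᵇ b)
<ᵇ-suc zero    b = refl
<ᵇ-suc (suc a) b = refl

filter-upTo : ∀ {q} (j : Fin q) → filterᵇ (λ k → toℕ k ℕ.≤ᵇ toℕ j) (allFin q) ≡ upTo j
filter-upTo {suc q} Fin.zero = cong (Fin.zero ∷_)
  (trans (filterᵇ-shift _) (cong (map Fin.suc) (filter-none (T? ∘ _) (universal (λ _ ()) (allFin q)))))
filter-upTo {suc q} (Fin.suc j) = cong (Fin.zero ∷_)
  (trans (filterᵇ-shift _)
    (cong (map Fin.suc) (trans (filterᵇ-cong (λ k → <ᵇ-suc (toℕ k) (toℕ j)) (allFin q)) (filter-upTo j))))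

filter-above : ∀ {q} (j : Fin q) → filterᵇ (λ k → toℕ j ℕ.<ᵇ toℕ k) (allFin q) ≡ above j
filter-above {suc q} Fin.zero = filter-all (T? ∘ _) (AllP.tabulate⁺ {f = Fin.suc} (λ _ → tt))
filter-above {suc q} (Fin.suc j) = trans (filterᵇ-shift _) (cong (map Fin.suc) (filter-above j))

reverse-upTo : ∀ {q} (j : Fin q) → reverse (upTo j) ≡ j ∷ below j
reverse-upTo Fin.zero    = refl
reverse-upTo (Fin.suc j) = begin
  reverse (Fin.zero ∷ map Fin.suc (upTo j)) ≡⟨ unfold-reverse Fin.zero (map Fin.suc (upTo j)) ⟩
  reverse (map Fin.suc (upTo j)) ∷ʳ Fin.zero ≡⟨ cong (_∷ʳ Fin.zero) (sym (reverse-map Fin.suc (upTo j))) ⟩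
  map Fin.suc (reverse (upTo j)) ∷ʳ Fin.zero ≡⟨ cong (λ t → map Fin.suc t ∷ʳ Fin.zero) (reverse-upTo j) ⟩
  Fin.suc j ∷ below (Fin.suc j)              ∎
  where open ≡-Reasoning

pathOrder-shape : ∀ {ℝ} (G : WGraph ℝ) {q} (es : Fin q → Fin (WGraph.m G)) (j : Fin q) →
  pathOrder G es j ≡ es j ∷ (map es (below j) ++ map es (above j))
pathOrder-shape G es j =
  cong₂ (λ a b → map es a ++ map es b) (trans (cong reverse (filter-upTo j)) (reverse-upTo j)) (filter-above j)

zero∈below : ∀ {q} (k : Fin (suc q)) → Fin.zero ∈ k ∷ below k
zero∈below Fin.zero    = here refl
zero∈below (Fin.suc k) = there (∈-++⁺ʳ (map Fin.suc (below k)) (here refl))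

inject₁≢suc : ∀ {q} (i : Fin q) → inject₁ i ≢ Fin.suc i
inject₁≢suc Fin.zero    ()
inject₁≢suc (Fin.suc i) eq = inject₁≢suc i (suc-injective eq)

inject₁²≢suc² : ∀ {q} (i : Fin q) → inject₁ (inject₁ i) ≢ Fin.suc (Fin.suc i)
inject₁²≢suc² Fin.zero    ()
inject₁²≢suc² (Fin.suc i) eq = inject₁²≢suc² i (suc-injective eq)

length-≥1 : ∀ {A : Set} {a : A} {xs} → a ∈ xs → 1 ℕ.≤ length xs
length-≥1 (here _)  = s≤s z≤n
length-≥1 (there _) = s≤s z≤n

length-≥2 : ∀ {A : Set} {a b : A} {xs} → a ≢ b → a ∈ xs → b ∈ xs → 2 ℕ.≤ length xs
length-≥2 a≢b (here a≡x) (here b≡x) = ⊥-elim (a≢b (trans a≡x (sym b≡x)))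
length-≥2 a≢b (here _)   (there b∈) = s≤s (length-≥1 b∈)
length-≥2 a≢b (there a∈) (here _)   = s≤s (length-≥1 a∈)
length-≥2 a≢b (there a∈) (there b∈) = ℕP.m≤n⇒m≤1+n (length-≥2 a≢b a∈ b∈)

length-≥3 : ∀ {A : Set} {a b c : A} {xs} → a ≢ b → a ≢ c → b ≢ c → a ∈ xs → b ∈ xs → c ∈ xs → 3 ℕ.≤ length xs
length-≥3 a≢b a≢c b≢c (here a≡x) (here b≡x) _          = ⊥-elim (a≢b (trans a≡x (sym b≡x)))
length-≥3 a≢b a≢c b≢c (here a≡x) (there _)  (here c≡x) = ⊥-elim (a≢c (trans a≡x (sym c≡x)))
length-≥3 a≢b a≢c b≢c (there _)  (here b≡x) (here c≡x) = ⊥-elim (b≢c (trans b≡x (sym c≡x)))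
length-≥3 a≢b a≢c b≢c (here _)   (there b∈) (there c∈) = s≤s (length-≥2 b≢c b∈ c∈)
length-≥3 a≢b a≢c b≢c (there a∈) (here _)   (there c∈) = s≤s (length-≥2 a≢c a∈ c∈)
length-≥3 a≢b a≢c b≢c (there a∈) (there b∈) (here _)   = s≤s (length-≥2 a≢b a∈ b∈)
length-≥3 a≢b a≢c b≢c (there a∈) (there b∈) (there c∈) = ℕP.m≤n⇒m≤1+n (length-≥3 a≢b a≢c b≢c a∈ b∈ c∈)

module PathOrder {ℝ : RealField} (G : WGraph ℝ) where
  open WGraph G
  open ResidualGraphs G
  open SequentialStrategies G

  pendantOrder-++ : ∀ {done} A {B} → PendantOrder done A → PendantOrder (A List.ʳ++ done) B →
    PendantOrder done (A ++ B)
  pendantOrder-++ []      _                order-B = order-B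
  pendantOrder-++ (f ∷ A) (f-pendant , order-A) order-B = f-pendant , pendantOrder-++ A order-A order-B

  ∈-ʳ++⁺ˡ : ∀ {x : Fin m} A {done} → x ∈ A → x ∈ A List.ʳ++ done
  ∈-ʳ++⁺ˡ A {done} x∈A = AnyP.reverseAcc⁺ done A (inj₂ x∈A)

  ∈-ʳ++⁺ʳ : ∀ {x : Fin m} A {done} → x ∈ done → x ∈ A List.ʳ++ done
  ∈-ʳ++⁺ʳ A {done} x∈done = AnyP.reverseAcc⁺ done A (inj₁ x∈done)

  Junction : Fin m → Fin m → Set
  Junction f g = ∃[ w ] Incident w f × Incident w g × (∀ h → Incident w h → h ≡ f ⊎ h ≡ g)

  junction-sym : ∀ {f g} → Junction f g → Junction g f
  junction-sym (w , w∈f , w∈g , only) = w , w∈g , w∈f , λ h w∈h → swap (only h w∈h)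

  junction⇒pendantAfter : ∀ {f g done} → Junction f g → g ∈ done → PendantAfter done f
  junction⇒pendantAfter {f} {g} {done} (w , w∈f , _ , only) g∈done = w , w∈f , λ h w∈h → f-or-done (only h w∈h)
    where
    f-or-done : ∀ {h} → h ≡ f ⊎ h ≡ g → h ≡ f ⊎ h ∈ done
    f-or-done (inj₁ h≡f)  = inj₁ h≡f
    f-or-done (inj₂ refl) = inj₂ g∈done

  Junctions : ∀ {q} → (Fin q → Fin m) → Set
  Junctions {zero}  es = ⊤
  Junctions {suc q} es = ∀ (i : Fin q) → Junction (es (inject₁ i)) (es (Fin.suc i))

  junctions-tail : ∀ {q} (es : Fin (suc q) → Fin m) → Junctions es → Junctions (es ∘ Fin.suc)
  junctions-tail {zero}  es _  = tt
  junctions-tail {suc q} es js = js ∘ Fin.suc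

  -- e_k, e_{k-1}, …, e_0: each edge is pendant once its successor is gone.
  below-order : ∀ {q} (es : Fin q → Fin m) → Junctions es → ∀ k done →
    PendantOrder (es k ∷ done) (map es (below k))
  below-order es js Fin.zero done = tt
  below-order {suc zero} es js (Fin.suc ()) done
  below-order {suc (suc q)} es js (Fin.suc k) done =
    subst (PendantOrder (es (Fin.suc k) ∷ done)) (sym shape)
      (pendantOrder-++ (map (es ∘ Fin.suc) (below k))
        (below-order (es ∘ Fin.suc) (junctions-tail es js) k done)
        (junction⇒pendantAfter (js Fin.zero) e₁-gone , tt))
    where
    shape : map es (below (Fin.suc k)) ≡ map (es ∘ Fin.suc) (below k) ++ es Fin.zero ∷ []
    shape = trans (map-++ es (map Fin.suc (below k)) (Fin.zero ∷ []))
                  (cong (_++ es Fin.zero ∷ []) (sym (map-∘ (below k))))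

    e₁-gone : es (Fin.suc Fin.zero) ∈ map (es ∘ Fin.suc) (below k) List.ʳ++ (es (Fin.suc k) ∷ done)
    e₁-gone with zero∈below k
    ... | here 0≡k     = ∈-ʳ++⁺ʳ (map (es ∘ Fin.suc) (below k)) (here (cong (es ∘ Fin.suc) 0≡k))
    ... | there 0∈below = ∈-ʳ++⁺ˡ (map (es ∘ Fin.suc) (below k)) (∈-map⁺ (es ∘ Fin.suc) 0∈below)

  -- e_1, …, e_q after e_0: each edge is pendant once its predecessor is gone.
  tail-order : ∀ {q} (es : Fin (suc q) → Fin m) → Junctions es → ∀ done → es Fin.zero ∈ done →
    PendantOrder done (List.tabulate (es ∘ Fin.suc))
  tail-order {zero}  es js done _       = tt
  tail-order {suc q} es js done e₀-gone =
    junction⇒pendantAfter (junction-sym (js Fin.zero)) e₀-gone ,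
    tail-order (es ∘ Fin.suc) (junctions-tail es js) _ (here refl)

  above-order : ∀ {q} (es : Fin q → Fin m) → Junctions es → ∀ k done → es k ∈ done →
    PendantOrder done (map es (above k))
  above-order {suc q} es js Fin.zero done e₀-gone =
    subst (PendantOrder done) (sym (map-tabulate Fin.suc es)) (tail-order es js done e₀-gone)
  above-order {suc q} es js (Fin.suc k) done eₖ-gone =
    subst (PendantOrder done) (map-∘ (above k)) (above-order (es ∘ Fin.suc) (junctions-tail es js) k done eₖ-gone)

  path-pendantOrder : ∀ {q} (es : Fin q → Fin m) → Junctions es → ∀ j →
    PendantOrder (es j ∷ []) (map es (below j) ++ map es (above j))
  path-pendantOrder es js j = pendantOrder-++ (map es (below j)) (below-order es js j [])
    (above-order es js j _ (∈-ʳ++⁺ʳ (map es (below j)) (here refl)))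

  low-degree-junction : ∀ w e₁ e₂ → deg G w ℕ.< 3 → e₁ ≢ e₂ → Incident w e₁ → Incident w e₂ →
    Junction e₁ e₂
  low-degree-junction w e₁ e₂ deg<3 e₁≢e₂ w∈e₁ w∈e₂ = w , w∈e₁ , w∈e₂ , only
    where
    incident-edge : ∀ h → Incident w h → h ∈ filterᵇ (incidentᵇ G w) (allFin m)
    incident-edge h w∈h = ∈-filter⁺ (T? ∘ incidentᵇ G w) (∈-allFin h)
      (subst T (sym (incidentᵇ-complete w h w∈h)) tt)

    only : ∀ h → Incident w h → h ≡ e₁ ⊎ h ≡ e₂
    only h w∈h with h Fin.≟ e₁ | h Fin.≟ e₂
    ... | yes h≡e₁ | _        = inj₁ h≡e₁
    ... | no _     | yes h≡e₂ = inj₂ h≡e₂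
    ... | no h≢e₁  | no h≢e₂  = ⊥-elim (ℕP.<⇒≱ deg<3
      (length-≥3 e₁≢e₂ (h≢e₁ ∘ sym) (h≢e₂ ∘ sym) (incident-edge e₁ w∈e₁) (incident-edge e₂ w∈e₂) (incident-edge h w∈h)))

  joins-left : ∀ {e a b} → Joins G e a b → Incident a e
  joins-left (inj₁ (x , _)) = inj₁ x
  joins-left (inj₂ (_ , y)) = inj₂ y

  joins-right : ∀ {e a b} → Joins G e a b → Incident b e
  joins-right (inj₁ (_ , y)) = inj₂ y
  joins-right (inj₂ (x , _)) = inj₁ x

  -- Consecutive edges e_i, e_{i+1} of a component path are distinct and meet
  -- at the inner vertex u_{i+1}, which has degree < 3.
  path-junctions : ∀ {q us es} → IsComponentPath G q us es → Junctions es
  path-junctions {zero}  _    = tt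
  path-junctions {suc q} {us} {es} path i =
    low-degree-junction (us (Fin.suc (inject₁ i))) _ _ (us-notV≥3 _) distinct
      (joins-right (es-joins (inject₁ i))) (joins-left (es-joins (Fin.suc i)))
    where
    open IsComponentPath path
    -- equal edges would force two of u_i, u_{i+1}, u_{i+2} to coincide
    distinct : es (inject₁ i) ≢ es (Fin.suc i)
    distinct eq with es-joins (inject₁ i) | subst (λ e → Joins G e _ _) (sym eq) (es-joins (Fin.suc i))
    ... | inj₁ (x≡a , _) | inj₁ (x≡b , _) =
      inject₁≢suc (inject₁ i) (us-injective _ _ (trans (sym x≡a) x≡b))
    ... | inj₁ (x≡a , _) | inj₂ (x≡c , _) = inject₁²≢suc² i (us-injective _ _ (trans (sym x≡a) x≡c))
    ... | inj₂ (_ , y≡a) | inj₁ (_ , y≡c) = inject₁²≢suc² i (us-injective _ _ (trans (sym y≡a) y≡c))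
    ... | inj₂ (x≡b , _) | inj₂ (x≡c , _) =
      inject₁≢suc i (suc-injective (us-injective _ _ (trans (sym x≡b) x≡c)))

lemma3 : (ℝ : RealField) (G : WGraph ℝ) (d : ℕ) →
    Connected G → WGraph.m G ℕ.≤ WGraph.n G ℕ.+ d → NoPendantEdges G →
    (q : ℕ) (us : Fin (suc q) → Fin (WGraph.n G)) (es : Fin q → Fin (WGraph.m G)) →
    IsComponentPath G q us es →
    (H : Graph G) (j : Fin q) → lookup H (es j) ≡ inside →
    (∃[ l ] ∃[ r ] Optimal G (query (es j) l r) H) →
    ∃[ cs ] OptimalCDT G (cnode H (strategyS G H es j) cs) H
lemma3 ℝ G _ _ _ _ q us es path H j ej∈H (l , r , ej-first-optimal) =
  subst (λ L → ∃[ cs ] OptimalCDT G (cnode H (sequential G L H) cs) H) (sym (pathOrder-shape G es j))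
    (optimalCDT-sequential (es j) (map es (below j) ++ map es (above j)) H ej∈H
      (optimal-first-query H (es j) l r ej-first-optimal)
      (path-pendantOrder es (path-junctions path) j))
  where
  open OptimalValue G
  open CDTConstruction G
  open PathOrder G
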